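{- Let $D_1$ and $D_2$ be symplectic difference sets in groups $G_1$ and $G_2$, respectively. Let $\phi : G_2 \to \mathrm{Aut}(G_1)$ be a homomorphism and let $G = G_1 \rtimes_\phi G_2$. Let $D = \big(D_1 \times (G_2 - D_2)\big) \cup \big((G_1 - D_1) \times D_2\big)$, viewed as a subset of the common underlying set $G_1 \times G_2$. If $(g_i, g_j) * D = (g_i, g_j) \cdot D$ for all $(g_i, g_j) \in G_1 \times G_2$, where $*$ denotes the multiplication of $G_1 \rtimes_\phi G_2$ and $\cdot$ denotes the multiplication of the direct product $G_1 \times G_2$, then $D$ is a symplectic difference set in $G_1 \rtimes_\phi G_2$.
   Context: A $(v,k,\lambda)$ difference set in a group $G$ of order $v$ is a subset $D$ of size $k$ such that the multiset $\{d_1 d_2^{ -1} : d_1,d_2 \in D\}$ contains every non-identity element of $G$ exactly $\lambda$ times. Its development is the symmetric design with points the elements of $G$, blocks the left translates $gD$ ($g\in G$), incidence by membership. Two symmetric designs with incidence matrices $A_1, A_2$ are isomorphic iff $A_1 = P A_2 Q$ for some permutation matrices $P, Q$. The symplectic design on $2^{2n}$ points is the design with incidence matrix $A = -\tfrac12\big((J_4 - 2I_4)^{\otimes n} - J\big)$, where $\otimes$ is the Kronecker product, $I_4$, $J_4$ are the $4\times 4$ identity and all-ones matrices and $J$ is the $4^n \times 4^n$ all-ones matrix. A symplectic difference set is a difference set (in a group of order $2^{2n}$) whose development is isomorphic to the symplectic design on $2^{2n}$ points. For a homomorphism $\phi: H \to \mathrm{Aut}(N)$, the semi-direct product $N \rtimes_\phi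 H$ has underlying set $N \times H$ and multiplication $(n_1,h_1)(n_2,h_2) = (n_1 \phi(h_1)(n_2), h_1 h_2)$. For $r$ in a group and a subset $D$, $rD$ denotes $\{rd : d \in D\}$ computed with the indicated multiplication. -}

module Defs where

open import Level using (Level; _⊔_) renaming (suc to lsuc)
open import Data.Bool using (Bool; true; false; _∧_; _∨_; if_then_else_; not)
open import Data.Nat using (ℕ; zero; suc; _^_)
import Data.Nat as ℕ
open import Data.Integer using (ℤ; +_; -_; _-_) renaming (_*_ to _*ℤ_)
open import Data.Fin using (Fin; remQuot; quotient; remainder)
open import Data.Fin.Properties using () renaming (_≟_ to _≟F_)
open import Data.List using (List; length; filterᵇ; cartesianProduct)
open import Data.Bool.ListAction using (any)
open import Data.List.Membership.Propositional using (_∈_)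
open import Data.List.Relation.Unary.Unique.Propositional using (Unique)
open import Data.Product using (_×_; _,_; proj₁; proj₂; Σ; ∃; ∃-syntax)
open import Relation.Binary.PropositionalEquality using (_≡_)
open import Relation.Binary.Definitions using (DecidableEquality)
open import Relation.Nullary using (¬_)
open import Relation.Nullary.Decidable using (⌊_⌋)
open import Algebra.Structures using (IsGroup)
open import Function.Bundles using (Bijection; _⤖_)
open import Function.Definitions using (Bijective)

-- Raw finite "group data": carrier with multiplication, identity,
-- inverse, decidable equality and a duplicate-free complete enumeration.
-- (Group laws are not needed to *state* the difference-set notions.)

record RawFinGroup : Set₁ where
  field
    Carrier  : Set
    _∙_      : Carrier → Carrier → Carrier
    ε        : Carrier
    _⁻¹      : Carrier → Carrier
    _≟_      : DecidableEquality Carrier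
    elems    : List Carrier
    complete : ∀ x → x ∈ elems
    unique   : Unique elems

record FinGroup : Set₁ where
  field
    raw     : RawFinGroup
  open RawFinGroup raw public
  field
    isGroup : IsGroup _≡_ _∙_ ε _⁻¹

module _ (G : RawFinGroup) where
  open RawFinGroup G

  card : (Carrier → Bool) → ℕ
  card D = length (filterᵇ D elems)

  diffCount : (Carrier → Bool) → Carrier → ℕ
  diffCount D g = length (filterᵇ
    (λ p → D (proj₁ p) ∧ D (proj₂ p) ∧ ⌊ (proj₁ p ∙ (proj₂ p ⁻¹)) ≟ g ⌋)
    (cartesianProduct elems elems))

  IsDifferenceSet : ℕ → ℕ → ℕ → (Carrier → Bool) → Set
  IsDifferenceSet v k λ′ D =
    length elems ≡ v × card D ≡ k × (∀ g → ¬ (g ≡ ε) → diffCount D g ≡ λ′)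

  inTranslateᵇ : (Carrier → Bool) → Carrier → Carrier → Bool
  inTranslateᵇ D g x = any (λ d → D d ∧ ⌊ x ≟ (g ∙ d) ⌋) elems

  -- incidence matrix of the development: rows = points x, columns = blocks gD
  devMatrix : (Carrier → Bool) → Carrier → Carrier → ℤ
  devMatrix D x g = if inTranslateᵇ D g x then + 1 else + 0

Matrix : ℕ → ℕ → Set
Matrix m n = Fin m → Fin n → ℤ

_⊗_ : ∀ {m n p q} → Matrix m n → Matrix p q → Matrix (m ℕ.* p) (n ℕ.* q)
(_⊗_ {m} {n} {p} {q} A B) x y =
  A (quotient {m} p x) (quotient {n} q y) *ℤ B (remainder {m} p x) (remainder {n} q y)

J₄-2I₄ : Matrix 4 4
J₄-2I₄ i j = if ⌊ i ≟F j ⌋ then - (+ 1) else + 1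

tensorPow : (n : ℕ) → Matrix (4 ^ n) (4 ^ n)
tensorPow zero    i j = + 1
tensorPow (suc n) = J₄-2I₄ ⊗ tensorPow n

-- The incidence matrix A of the symplectic
-- design on 2^{2n} points is A = -½((J₄-2I₄)^{⊗n} - J), i.e.
-- -2 · A i j = (J₄-2I₄)^{⊗n} i j - 1.  "Design of D in G is isomorphic to it":
-- there are bijections σ (rows/points), τ (columns/blocks) from Fin (4^n)
-- onto G with devMatrix (σ i) (τ j) = A i j, i.e. Dev = P A Q.
IsoToSymplectic : (G : RawFinGroup) → (RawFinGroup.Carrier G → Bool) → ℕ → Set
IsoToSymplectic G D n =
  Σ (Fin (4 ^ n) ⤖ Carrier) λ σ → Σ (Fin (4 ^ n) ⤖ Carrier) λ τ →
    ∀ i j → - (+ 2) *ℤ devMatrix G D (Bijection.to σ i) (Bijection.to τ j)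
            ≡ tensorPow n i j - + 1
  where open RawFinGroup G

IsSymplecticDifferenceSet : (G : RawFinGroup) → (RawFinGroup.Carrier G → Bool) → Set
IsSymplecticDifferenceSet G D =
  (∃[ v ] ∃[ k ] ∃[ λ′ ] IsDifferenceSet G v k λ′ D) × (∃[ n ] IsoToSymplectic G D n)

module _ (N H : FinGroup) where
  private
    module N = FinGroup N
    module H = FinGroup H

  record IsAutAction (φ : H.Carrier → N.Carrier → N.Carrier) : Set where
    field
      φ-auto-hom : ∀ h a b → φ h (a N.∙ b) ≡ φ h a N.∙ φ h b
      φ-auto-bij : ∀ h → Bijective _≡_ _≡_ (φ h)
      φ-hom      : ∀ h₁ h₂ a → φ (h₁ H.∙ h₂) a ≡ φ h₁ (φ h₂ a)

module _ {A B : Set} where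
  open import Data.List.Membership.Propositional.Properties using (∈-cartesianProduct⁺)
  open import Data.List.Relation.Unary.Unique.Propositional.Properties using (cartesianProduct⁺)

  private
    pairEnumComplete : (xs : List A) (ys : List B) → (∀ x → x ∈ xs) → (∀ y → y ∈ ys) →
                       ∀ p → p ∈ cartesianProduct xs ys
    pairEnumComplete xs ys cx cy (a , b) = ∈-cartesianProduct⁺ (cx a) (cy b)

  pairComplete = pairEnumComplete
  pairUnique : {xs : List A} {ys : List B} → Unique xs → Unique ys → Unique (cartesianProduct xs ys)
  pairUnique = cartesianProduct⁺

module _ (N H : FinGroup) where
  private
    module N = FinGroup N
    module H = FinGroup H
    open import Data.Product.Properties using (≡-dec)

  semidirect : (H.Carrier → N.Carrier → N.Carrier) → RawFinGroup
  semidirect φ = record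
    { Carrier  = N.Carrier × H.Carrier
    ; _∙_      = λ p q → (proj₁ p N.∙ φ (proj₂ p) (proj₁ q)) , (proj₂ p H.∙ proj₂ q)
    ; ε        = N.ε , H.ε
    ; _⁻¹      = λ p → φ (proj₂ p H.⁻¹) (proj₁ p N.⁻¹) , (proj₂ p H.⁻¹)
    ; _≟_      = ≡-dec N._≟_ H._≟_
    ; elems    = cartesianProduct N.elems H.elems
    ; complete = pairComplete N.elems H.elems N.complete H.complete
    ; unique   = pairUnique N.unique H.unique
    }

  direct : RawFinGroup
  direct = record
    { Carrier  = N.Carrier × H.Carrier
    ; _∙_      = λ p q → (proj₁ p N.∙ proj₁ q) , (proj₂ p H.∙ proj₂ q)
    ; ε        = N.ε , H.ε
    ; _⁻¹      = λ p → (proj₁ p N.⁻¹) , (proj₂ p H.⁻¹)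
    ; _≟_      = ≡-dec N._≟_ H._≟_
    ; elems    = cartesianProduct N.elems H.elems
    ; complete = pairComplete N.elems H.elems N.complete H.complete
    ; unique   = pairUnique N.unique H.unique
    }

  productSet : (N.Carrier → Bool) → (H.Carrier → Bool) → N.Carrier × H.Carrier → Bool
  productSet D₁ D₂ (a , b) = (D₁ a ∧ not (D₂ b)) ∨ (not (D₁ a) ∧ D₂ b)

InTranslate : {C : Set} → (C → C → C) → (C → Bool) → C → C → Set
InTranslate {C} _∙_ D r x = ∃[ d ] (D d ≡ true × x ≡ r ∙ d)

SameTranslates : {C : Set} → (C → C → C) → (C → C → C) → (C → Bool) → C → Set
SameTranslates _*_ _·_ D r =
  ∀ x → (InTranslate _*_ D r x → InTranslate _·_ D r x) × (InTranslate _·_ D r x → InTranslate _*_ D r x)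

{-# OPTIONS --safe #-}
module Submission where

-- Write incidence in ±1 form, sign b = 1 − 2[b]. A development is then the symplectic
-- design of order n exactly when its ±1 matrix is (J₄ − 2I₄)^{⊗n} up to reordering rows
-- and columns, and the columns of that Kronecker power all sum to 2ⁿ and are pairwise
-- orthogonal. These two facts already make D a difference set in any group: from
-- 4[x ∈ D ∧ x ∈ gD] = sign_D(x)·sign_gD(x) + 1 − sign_D(x) − sign_gD(x), summing over x
-- gives 4|D ∩ gD| = |G| − 2ⁿ⁺¹ for every g ≠ 1.
-- The set D is the "exclusive or" of D₁ and D₂, so in the direct product its ±1 development
-- is the Kronecker product of those of D₁ and D₂, i.e. the symplectic matrix of order
-- n₁ + n₂. The hypothesis on translates makes the developments of D in the direct and in the
-- semidirect product coincide, and the semidirect product is a group.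

open import Defs
open import Algebra.Bundles using (Group)
open import Algebra.Structures using (IsGroup)
import Algebra.Properties.Group as GroupProperties
open import Data.Bool using (Bool; true; false; _∧_; _∨_; not; if_then_else_)
open import Data.Bool.Properties using (T-≡; T-∧; ∧-zeroʳ; ∧-identityʳ; ⇔→≡)
open import Data.Empty using (⊥-elim)
open import Data.Fin using (Fin; zero; combine; quotient; remainder)
open import Data.Fin.Properties
  using (all?; *↔×; remQuot-combine; combine-remQuot; combine-surjective) renaming (_≟_ to _≟F_)
open import Data.Integer using (ℤ; +_; -_; _+_; _-_; _*_)
import Data.Integer.Properties as ℤ
open import Data.Integer.Tactic.RingSolver using (solve-∀)
open import Data.List using (List; []; _∷_; _++_; map; length; filterᵇ; cartesianProduct; allFin)
open import Data.List.Membership.Propositional using (_∈_; lose)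
open import Data.List.Membership.Propositional.Properties
  using (∈-map⁺; ∈-allFin; ∈-cartesianProduct⁺)
open import Data.List.Membership.Propositional.Properties.WithK using (unique∧set⇒bag)
open import Data.List.Relation.Binary.BagAndSetEquality using (∼bag⇒↭)
open import Data.List.Relation.Binary.Permutation.Propositional using (_↭_; refl; prep; swap; trans)
open import Data.List.Relation.Unary.All as All using (All; []; _∷_)
open import Data.List.Relation.Unary.Any using (here; there; satisfied)
open import Data.List.Relation.Unary.Any.Properties using (any⁺; any⁻)
open import Data.List.Relation.Unary.Unique.Propositional using (Unique; _∷_)
open import Data.List.Relation.Unary.Unique.Propositional.Properties
  using (map⁺; allFin⁺; cartesianProduct⁺)
open import Data.Nat as ℕ using (ℕ; zero; suc; _^_; _∸_)
open import Data.Nat.DivMod using (_/_; m*n/n≡m)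
open import Data.Nat.Properties using (m+n∸n≡m)
open import Data.Product using (_×_; _,_; proj₁; proj₂; uncurry; ∃-syntax)
open import Data.Product.Function.NonDependent.Propositional using (_×-⤖_)
open import Data.Sum using (_⊎_; inj₁; inj₂)
open import Function using (_∘_)
open import Function.Bundles using (_⇔_; mk⇔; Equivalence; _⤖_; Bijection; _↔_; mk↔ₛ′)
open import Function.Construct.Composition using (_⤖-∘_; _⇔-∘_)
import Function.Construct.Identity as Identity
open import Function.Construct.Symmetry using (⇔-sym)
open import Function.Properties.Inverse using (↔⇒⤖; ↔-sym)
open import Relation.Binary.PropositionalEquality as ≡
  using (_≡_; _≢_; cong; cong₂; sym; subst; isEquivalence)
open import Relation.Nullary using (yes; no)
open import Relation.Nullary.Decidable using (⌊_⌋; toWitness; fromWitness; _⊎-dec_)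

private variable
  A B : Set

∑ : List A → (A → ℤ) → ℤ
∑ []       f = + 0
∑ (x ∷ xs) f = f x + ∑ xs f

infix 5 ∑
syntax ∑ xs (λ x → e) = ∑[ x ∈ xs ] e

⟦_⟧ : Bool → ℤ
⟦ true ⟧  = + 1
⟦ false ⟧ = + 0

∑-cong : (xs : List A) {f g : A → ℤ} → (∀ x → f x ≡ g x) → ∑ xs f ≡ ∑ xs g
∑-cong []       f≗g = ≡.refl
∑-cong (x ∷ xs) f≗g = cong₂ _+_ (f≗g x) (∑-cong xs f≗g)

∑-+ : (xs : List A) (f g : A → ℤ) → ∑[ x ∈ xs ] (f x + g x) ≡ ∑ xs f + ∑ xs g
∑-+ []       f g = ≡.refl
∑-+ (x ∷ xs) f g =
  ≡.trans (cong (_+_ (f x + g x)) (∑-+ xs f g)) (interchange (f x) (g x) (∑ xs f) (∑ xs g))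
  where
  interchange : ∀ a b c d → (a + b) + (c + d) ≡ (a + c) + (b + d)
  interchange = solve-∀

∑-*ˡ : (xs : List A) (c : ℤ) (f : A → ℤ) → ∑[ x ∈ xs ] (c * f x) ≡ c * ∑ xs f
∑-*ˡ []       c f = sym (ℤ.*-zeroʳ c)
∑-*ˡ (x ∷ xs) c f =
  ≡.trans (cong (_+_ (c * f x)) (∑-*ˡ xs c f)) (sym (ℤ.*-distribˡ-+ c (f x) (∑ xs f)))

∑-*ʳ : (xs : List A) (c : ℤ) (f : A → ℤ) → ∑[ x ∈ xs ] (f x * c) ≡ ∑ xs f * c
∑-*ʳ []       c f = sym (ℤ.*-zeroˡ c)
∑-*ʳ (x ∷ xs) c f =
  ≡.trans (cong (_+_ (f x * c)) (∑-*ʳ xs c f)) (sym (ℤ.*-distribʳ-+ c (f x) (∑ xs f)))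

∑-const : (xs : List A) (c : ℤ) → ∑[ x ∈ xs ] c ≡ + length xs * c
∑-const []       c = ≡.refl
∑-const (x ∷ xs) c = ≡.trans (cong (_+_ c) (∑-const xs c)) (sym (ℤ.suc-* (+ length xs) c))

∑-map : (h : A → B) (xs : List A) (f : B → ℤ) → ∑ (map h xs) f ≡ ∑[ x ∈ xs ] f (h x)
∑-map h []       f = ≡.refl
∑-map h (x ∷ xs) f = cong (_+_ (f (h x))) (∑-map h xs f)

∑-++ : (xs ys : List A) (f : A → ℤ) → ∑ (xs ++ ys) f ≡ ∑ xs f + ∑ ys f
∑-++ []       ys f = sym (ℤ.+-identityˡ (∑ ys f))
∑-++ (x ∷ xs) ys f =
  ≡.trans (cong (_+_ (f x)) (∑-++ xs ys f)) (sym (ℤ.+-assoc (f x) (∑ xs f) (∑ ys f)))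

∑-cartesianProduct : (xs : List A) (ys : List B) (f : A × B → ℤ) →
                     ∑ (cartesianProduct xs ys) f ≡ ∑[ x ∈ xs ] ∑[ y ∈ ys ] f (x , y)
∑-cartesianProduct []       ys f = ≡.refl
∑-cartesianProduct (x ∷ xs) ys f =
  ≡.trans (∑-++ (map (x ,_) ys) (cartesianProduct xs ys) f)
          (cong₂ _+_ (∑-map (x ,_) ys f) (∑-cartesianProduct xs ys f))

length-filterᵇ : (p : A → Bool) (xs : List A) → + length (filterᵇ p xs) ≡ ∑[ x ∈ xs ] ⟦ p x ⟧
length-filterᵇ p []       = ≡.refl
length-filterᵇ p (x ∷ xs) with p x
... | true  = cong (_+_ (+ 1)) (length-filterᵇ p xs)
... | false = ≡.trans (length-filterᵇ p xs) (sym (ℤ.+-identityˡ _))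

∑-zero : (xs : List A) {f : A → ℤ} → All (λ x → f x ≡ + 0) xs → ∑ xs f ≡ + 0
∑-zero []       []           = ≡.refl
∑-zero (x ∷ xs) (fx≡0 ∷ f≡0) = cong₂ _+_ fx≡0 (∑-zero xs f≡0)

∑-single : {xs : List A} {f : A → ℤ} {c : A} → Unique xs → c ∈ xs →
           (∀ y → y ≢ c → f y ≡ + 0) → ∑ xs f ≡ f c
∑-single {xs = c ∷ xs} {f} (c∉xs ∷ _) (here ≡.refl) f≡0 =
  ≡.trans (cong (_+_ (f c)) (∑-zero xs (All.map (λ c≢y → f≡0 _ (c≢y ∘ sym)) c∉xs)))
          (ℤ.+-identityʳ (f c))
∑-single {xs = x ∷ xs} {f} (x∉xs ∷ xs!) (there c∈xs) f≡0 =
  ≡.trans (cong (_+ ∑ xs f) (f≡0 x (All.lookup x∉xs c∈xs)))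
          (≡.trans (ℤ.+-identityˡ _) (∑-single xs! c∈xs f≡0))

∑-↭ : {xs ys : List A} (f : A → ℤ) → xs ↭ ys → ∑ xs f ≡ ∑ ys f
∑-↭ f refl         = ≡.refl
∑-↭ f (prep x p)   = cong (_+_ (f x)) (∑-↭ f p)
∑-↭ f (swap x y p) = swapHeads (f x) (f y) (∑-↭ f p)
  where
  swapHeads : ∀ a b {c d} → c ≡ d → a + (b + c) ≡ b + (a + d)
  swapHeads a b {c} ≡.refl =
    ≡.trans (sym (ℤ.+-assoc a b c)) (≡.trans (cong (_+ c) (ℤ.+-comm a b)) (ℤ.+-assoc b a c))
∑-↭ f (trans p q)  = ≡.trans (∑-↭ f p) (∑-↭ f q)

IsEnumeration : List A → Set
IsEnumeration xs = Unique xs × (∀ x → x ∈ xs)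

∑-enumeration : {xs ys : List A} (f : A → ℤ) →
                IsEnumeration xs → IsEnumeration ys → ∑ xs f ≡ ∑ ys f
∑-enumeration f (xs! , ∈xs) (ys! , ∈ys) =
  ∑-↭ f (∼bag⇒↭ (unique∧set⇒bag xs! ys! (λ {z} → mk⇔ (λ _ → ∈ys z) (λ _ → ∈xs z))))

map-enumeration : {xs : List A} (e : A ⤖ B) →
                  IsEnumeration xs → IsEnumeration (map (Bijection.to e) xs)
map-enumeration {xs = xs} e (xs! , ∈xs) = map⁺ (Bijection.injective e) xs! , ∈map
  where
  ∈map : ∀ y → y ∈ map (Bijection.to e) xs
  ∈map y with x , to-x≡y ← Bijection.surjective e y =
    subst (_∈ map _ xs) (to-x≡y ≡.refl) (∈-map⁺ _ (∈xs x))

∑-⤖ : {xs : List A} {ys : List B} (f : B → ℤ) (e : A ⤖ B) →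
      IsEnumeration xs → IsEnumeration ys → ∑ ys f ≡ ∑[ x ∈ xs ] f (Bijection.to e x)
∑-⤖ {xs = xs} f e xs-enum ys-enum =
  ≡.trans (∑-enumeration f ys-enum (map-enumeration e xs-enum)) (∑-map (Bijection.to e) xs f)

allFin-enumeration : ∀ n → IsEnumeration (allFin n)
allFin-enumeration n = allFin⁺ n , ∈-allFin

∑-allFin-* : ∀ m n (f : Fin (m ℕ.* n) → ℤ) →
             ∑ (allFin (m ℕ.* n)) f ≡ ∑[ a ∈ allFin m ] ∑[ b ∈ allFin n ] f (combine a b)
∑-allFin-* m n f =
  ≡.trans (∑-⤖ f (↔⇒⤖ (↔-sym *↔×)) pairs-enumeration (allFin-enumeration (m ℕ.* n)))
          (∑-cartesianProduct (allFin m) (allFin n) (f ∘ uncurry combine))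
  where
  pairs-enumeration : IsEnumeration (cartesianProduct (allFin m) (allFin n))
  pairs-enumeration = cartesianProduct⁺ (allFin⁺ m) (allFin⁺ n)
                    , λ (a , b) → ∈-cartesianProduct⁺ (∈-allFin a) (∈-allFin b)

columnSum : ∀ {m n} → Matrix m n → Fin n → ℤ
columnSum {m} A j = ∑[ i ∈ allFin m ] A i j

columnDot : ∀ {m n} → Matrix m n → Fin n → Fin n → ℤ
columnDot {m} A j j′ = ∑[ i ∈ allFin m ] A i j * A i j′

columnSum-J₄-2I₄ : ∀ q → columnSum J₄-2I₄ q ≡ + 2
columnSum-J₄-2I₄ = toWitness {a? = all? λ q → columnSum J₄-2I₄ q ℤ.≟ + 2} _

columnDot-J₄-2I₄ : ∀ q q′ → q ≡ q′ ⊎ columnDot J₄-2I₄ q q′ ≡ + 0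
columnDot-J₄-2I₄ =
  toWitness {a? = all? λ q → all? λ q′ → (q ≟F q′) ⊎-dec (columnDot J₄-2I₄ q q′ ℤ.≟ + 0)} _

⊗-combine : ∀ {m n p q} (A : Matrix m n) (B : Matrix p q) a a′ b b′ →
            (A ⊗ B) (combine a b) (combine a′ b′) ≡ A a a′ * B b b′
⊗-combine {m} {n} {p} {q} A B a a′ b b′ =
  cong₂ (λ (a , b) (a′ , b′) → A a a′ * B b b′)
        (remQuot-combine {m} {p} a b) (remQuot-combine {n} {q} a′ b′)

columnSum-⊗ : ∀ {m n p q} (A : Matrix m n) (B : Matrix p q) j k →
              columnSum (A ⊗ B) (combine j k) ≡ columnSum A j * columnSum B k
columnSum-⊗ {m} {n} {p} {q} A B j k = begin
  columnSum (A ⊗ B) (combine j k)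
    ≡⟨ ∑-allFin-* m p _ ⟩
  ∑[ a ∈ allFin m ] ∑[ b ∈ allFin p ] (A ⊗ B) (combine a b) (combine j k)
    ≡⟨ ∑-cong (allFin m) (λ a → ∑-cong (allFin p) (λ b → ⊗-combine A B a j b k)) ⟩
  ∑[ a ∈ allFin m ] ∑[ b ∈ allFin p ] A a j * B b k
    ≡⟨ ∑-cong (allFin m) (λ a → ∑-*ˡ (allFin p) (A a j) (λ b → B b k)) ⟩
  ∑[ a ∈ allFin m ] A a j * columnSum B k
    ≡⟨ ∑-*ʳ (allFin m) (columnSum B k) (λ a → A a j) ⟩
  columnSum A j * columnSum B k
    ∎
  where open ≡.≡-Reasoning

columnDot-⊗ : ∀ {m n p q} (A : Matrix m n) (B : Matrix p q) j j′ k k′ →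
              columnDot (A ⊗ B) (combine j k) (combine j′ k′) ≡ columnDot A j j′ * columnDot B k k′
columnDot-⊗ {m} {n} {p} {q} A B j j′ k k′ = begin
  columnDot (A ⊗ B) (combine j k) (combine j′ k′)
    ≡⟨ ∑-allFin-* m p _ ⟩
  ∑[ a ∈ allFin m ] ∑[ b ∈ allFin p ]
    (A ⊗ B) (combine a b) (combine j k) * (A ⊗ B) (combine a b) (combine j′ k′)
    ≡⟨ ∑-cong (allFin m) (λ a → ∑-cong (allFin p) (λ b → entry a b)) ⟩
  ∑[ a ∈ allFin m ] ∑[ b ∈ allFin p ] (A a j * A a j′) * (B b k * B b k′)
    ≡⟨ ∑-cong (allFin m) (λ a → ∑-*ˡ (allFin p) (A a j * A a j′) (λ b → B b k * B b k′)) ⟩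
  ∑[ a ∈ allFin m ] (A a j * A a j′) * columnDot B k k′
    ≡⟨ ∑-*ʳ (allFin m) (columnDot B k k′) (λ a → A a j * A a j′) ⟩
  columnDot A j j′ * columnDot B k k′
    ∎
  where
  open ≡.≡-Reasoning
  interchange : ∀ w x y z → (w * x) * (y * z) ≡ (w * y) * (x * z)
  interchange = solve-∀
  entry : ∀ a b → (A ⊗ B) (combine a b) (combine j k) * (A ⊗ B) (combine a b) (combine j′ k′)
                  ≡ (A a j * A a j′) * (B b k * B b k′)
  entry a b = ≡.trans (cong₂ _*_ (⊗-combine A B a j b k) (⊗-combine A B a j′ b k′))
                      (interchange (A a j) (B b k) (A a j′) (B b k′))

columnSum-tensorPow : ∀ n j → columnSum (tensorPow n) j ≡ + (2 ^ n)
columnSum-tensorPow zero    j = ≡.refl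
columnSum-tensorPow (suc n) j with q , r , ≡.refl ← combine-surjective {4} {4 ^ n} j = begin
  columnSum (J₄-2I₄ ⊗ tensorPow n) (combine q r)
    ≡⟨ columnSum-⊗ J₄-2I₄ (tensorPow n) q r ⟩
  columnSum J₄-2I₄ q * columnSum (tensorPow n) r
    ≡⟨ cong₂ _*_ (columnSum-J₄-2I₄ q) (columnSum-tensorPow n r) ⟩
  + 2 * + (2 ^ n)
    ≡⟨ ℤ.pos-* 2 (2 ^ n) ⟨
  + (2 ^ suc n)
    ∎
  where open ≡.≡-Reasoning

columnDot-tensorPow : ∀ n j j′ → j ≢ j′ → columnDot (tensorPow n) j j′ ≡ + 0
columnDot-tensorPow zero    zero zero j≢j′ = ⊥-elim (j≢j′ ≡.refl)
columnDot-tensorPow (suc n) j    j′   j≢j′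
  with q , r , ≡.refl ← combine-surjective {4} {4 ^ n} j
     | q′ , r′ , ≡.refl ← combine-surjective {4} {4 ^ n} j′ =
  ≡.trans (columnDot-⊗ J₄-2I₄ (tensorPow n) q q′ r r′) (vanishes (columnDot-J₄-2I₄ q q′))
  where
  vanishes : q ≡ q′ ⊎ columnDot J₄-2I₄ q q′ ≡ + 0 →
             columnDot J₄-2I₄ q q′ * columnDot (tensorPow n) r r′ ≡ + 0
  vanishes (inj₂ dot≡0) =
    ≡.trans (cong (_* columnDot (tensorPow n) r r′) dot≡0) (ℤ.*-zeroˡ (columnDot (tensorPow n) r r′))
  vanishes (inj₁ ≡.refl) =
    ≡.trans (cong (columnDot J₄-2I₄ q q *_) (columnDot-tensorPow n r r′ (j≢j′ ∘ cong (combine q))))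
            (ℤ.*-zeroʳ (columnDot J₄-2I₄ q q))

splitDigits : ∀ a b → Fin (4 ^ (a ℕ.+ b)) → Fin (4 ^ a) × Fin (4 ^ b)
splitDigits zero    b i = zero , i
splitDigits (suc a) b i = combine (quotient {4} (4 ^ (a ℕ.+ b)) i) (proj₁ xy) , proj₂ xy
  where xy = splitDigits a b (remainder {4} (4 ^ (a ℕ.+ b)) i)

joinDigits : ∀ a b → Fin (4 ^ a) × Fin (4 ^ b) → Fin (4 ^ (a ℕ.+ b))
joinDigits zero    b (_ , y) = y
joinDigits (suc a) b (x , y) =
  combine (quotient {4} (4 ^ a) x) (joinDigits a b (remainder {4} (4 ^ a) x , y))

joinDigits-splitDigits : ∀ a b i → joinDigits a b (splitDigits a b i) ≡ i
joinDigits-splitDigits zero    b i = ≡.refl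
joinDigits-splitDigits (suc a) b i = begin
  joinDigits (suc a) b (combine q x , y)
    ≡⟨ cong (λ (q , x) → combine q (joinDigits a b (x , y))) (remQuot-combine q x) ⟩
  combine q (joinDigits a b (splitDigits a b r))
    ≡⟨ cong (combine q) (joinDigits-splitDigits a b r) ⟩
  combine q r
    ≡⟨ combine-remQuot {4} (4 ^ (a ℕ.+ b)) i ⟩
  i ∎
  where
  open ≡.≡-Reasoning
  q = quotient {4} (4 ^ (a ℕ.+ b)) i
  r = remainder {4} (4 ^ (a ℕ.+ b)) i
  x = proj₁ (splitDigits a b r)
  y = proj₂ (splitDigits a b r)

splitDigits-joinDigits : ∀ a b p → splitDigits a b (joinDigits a b p) ≡ p
splitDigits-joinDigits zero    b (zero , y) = ≡.refl
splitDigits-joinDigits (suc a) b (x , y) = begin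
  splitDigits (suc a) b (combine q (joinDigits a b (r , y)))
    ≡⟨ cong (λ (q , r) → combine q (proj₁ (splitDigits a b r)) , proj₂ (splitDigits a b r))
            (remQuot-combine q (joinDigits a b (r , y))) ⟩
  combine q (proj₁ (splitDigits a b (joinDigits a b (r , y))))
    , proj₂ (splitDigits a b (joinDigits a b (r , y)))
    ≡⟨ cong (λ (r , y) → combine q r , y) (splitDigits-joinDigits a b (r , y)) ⟩
  combine q r , y
    ≡⟨ cong (_, y) (combine-remQuot {4} (4 ^ a) x) ⟩
  x , y ∎
  where
  open ≡.≡-Reasoning
  q = quotient {4} (4 ^ a) x
  r = remainder {4} (4 ^ a) x

4^+↔× : ∀ a b → Fin (4 ^ (a ℕ.+ b)) ↔ (Fin (4 ^ a) × Fin (4 ^ b))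
4^+↔× a b =
  mk↔ₛ′ (splitDigits a b) (joinDigits a b) (splitDigits-joinDigits a b) (joinDigits-splitDigits a b)

tensorPow-+ : ∀ a b i j →
  tensorPow (a ℕ.+ b) i j ≡
  tensorPow a (proj₁ (splitDigits a b i)) (proj₁ (splitDigits a b j))
    * tensorPow b (proj₂ (splitDigits a b i)) (proj₂ (splitDigits a b j))
tensorPow-+ zero    b i j = sym (ℤ.*-identityˡ _)
tensorPow-+ (suc a) b i j = begin
  J₄-2I₄ qi qj * tensorPow (a ℕ.+ b) ri rj
    ≡⟨ cong (J₄-2I₄ qi qj *_) (tensorPow-+ a b ri rj) ⟩
  J₄-2I₄ qi qj * (tensorPow a xi xj * tensorPow b yi yj)
    ≡⟨ ℤ.*-assoc (J₄-2I₄ qi qj) _ _ ⟨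
  (J₄-2I₄ qi qj * tensorPow a xi xj) * tensorPow b yi yj
    ≡⟨ cong (_* tensorPow b yi yj) (⊗-combine J₄-2I₄ (tensorPow a) qi qj xi xj) ⟨
  tensorPow (suc a) (combine qi xi) (combine qj xj) * tensorPow b yi yj
    ∎
  where
  open ≡.≡-Reasoning
  qi = quotient {4} (4 ^ (a ℕ.+ b)) i
  qj = quotient {4} (4 ^ (a ℕ.+ b)) j
  ri = remainder {4} (4 ^ (a ℕ.+ b)) i
  rj = remainder {4} (4 ^ (a ℕ.+ b)) j
  xi = proj₁ (splitDigits a b ri)
  yi = proj₂ (splitDigits a b ri)
  xj = proj₁ (splitDigits a b rj)
  yj = proj₂ (splitDigits a b rj)

module _ (R : RawFinGroup) where
  open RawFinGroup R

  inTranslateᵇ⇔InTranslate : ∀ D g x → inTranslateᵇ R D g x ≡ true ⇔ InTranslate _∙_ D g x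
  inTranslateᵇ⇔InTranslate D g x = mk⇔ to from
    where
    p : Carrier → Bool
    p d = D d ∧ ⌊ x ≟ (g ∙ d) ⌋
    to : inTranslateᵇ R D g x ≡ true → InTranslate _∙_ D g x
    to any≡true with d , pd ← satisfied (any⁻ p elems (Equivalence.from T-≡ any≡true))
                with Dd , x≡gd ← Equivalence.to T-∧ pd =
      d , Equivalence.to T-≡ Dd , toWitness x≡gd
    from : InTranslate _∙_ D g x → inTranslateᵇ R D g x ≡ true
    from (d , Dd , x≡gd) = Equivalence.to T-≡
      (any⁺ p (lose (complete d) (Equivalence.from T-∧ (Equivalence.from T-≡ Dd , fromWitness x≡gd))))

module FinGroupProperties (G : FinGroup) where
  open FinGroup G

  group : Group _ _
  group = record { isGroup = isGroup }

  open Group group using (_\\_; identityˡ)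
  open GroupProperties group
    using (\\-leftDividesˡ; y≈x\\z; x≈z//y; ⁻¹-involutive; ⁻¹-anti-homo-∙; ε⁻¹≈ε)

  elems-enumeration : IsEnumeration elems
  elems-enumeration = unique , complete

  inTranslateᵇ≡ : ∀ D g x → inTranslateᵇ raw D g x ≡ D (g \\ x)
  inTranslateᵇ≡ D g x = ⇔→≡ (translate⇔ ⇔-∘ inTranslateᵇ⇔InTranslate raw D g x)
    where
    translate⇔ : InTranslate _∙_ D g x ⇔ (D (g \\ x) ≡ true)
    translate⇔ = mk⇔ (λ (d , Dd , x≡gd) → subst (λ d → D d ≡ true) (y≈x\\z g d x (sym x≡gd)) Dd)
                     (λ Dg\\x → g \\ x , Dg\\x , sym (\\-leftDividesˡ g x))

  ε\\x≡x : ∀ x → ε \\ x ≡ x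
  ε\\x≡x x = ≡.trans (cong (_∙ x) ε⁻¹≈ε) (identityˡ x)

  x∙y⁻¹≡g⇒y≡g\\x : ∀ {x y g} → x ∙ (y ⁻¹) ≡ g → y ≡ g \\ x
  x∙y⁻¹≡g⇒y≡g\\x {x} {y} {g} x∙y⁻¹≡g =
    y≈x\\z g y x (sym (≡.trans (x≈z//y x (y ⁻¹) g x∙y⁻¹≡g) (cong (g ∙_) (⁻¹-involutive y))))

  x∙[g\\x]⁻¹≡g : ∀ x g → x ∙ ((g \\ x) ⁻¹) ≡ g
  x∙[g\\x]⁻¹≡g x g =
    ≡.trans (cong (x ∙_) (≡.trans (⁻¹-anti-homo-∙ (g ⁻¹) x) (cong ((x ⁻¹) ∙_) (⁻¹-involutive g))))
            (\\-leftDividesˡ x g)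

  diffCount≡∑ : ∀ D g → + diffCount raw D g ≡ ∑[ x ∈ elems ] ⟦ D x ∧ D (g \\ x) ⟧
  diffCount≡∑ D g =
    ≡.trans (length-filterᵇ _ (cartesianProduct elems elems))
    (≡.trans (∑-cartesianProduct elems elems _)
             (∑-cong elems λ x →
               ≡.trans (∑-single unique (complete (g \\ x)) (off-diagonal x)) (on-diagonal x)))
    where
    off-diagonal : ∀ x y → y ≢ g \\ x → ⟦ D x ∧ D y ∧ ⌊ (x ∙ (y ⁻¹)) ≟ g ⌋ ⟧ ≡ + 0
    off-diagonal x y y≢g\\x with (x ∙ (y ⁻¹)) ≟ g
    ... | yes x∙y⁻¹≡g = ⊥-elim (y≢g\\x (x∙y⁻¹≡g⇒y≡g\\x x∙y⁻¹≡g))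
    ... | no _        = cong ⟦_⟧ (≡.trans (cong (D x ∧_) (∧-zeroʳ (D y))) (∧-zeroʳ (D x)))
    on-diagonal : ∀ x → ⟦ D x ∧ D (g \\ x) ∧ ⌊ (x ∙ ((g \\ x) ⁻¹)) ≟ g ⌋ ⟧ ≡ ⟦ D x ∧ D (g \\ x) ⟧
    on-diagonal x with (x ∙ ((g \\ x) ⁻¹)) ≟ g
    ... | yes _           = cong (λ b → ⟦ D x ∧ b ⟧) (∧-identityʳ (D (g \\ x)))
    ... | no x∙[g\\x]⁻¹≢g = ⊥-elim (x∙[g\\x]⁻¹≢g (x∙[g\\x]⁻¹≡g x g))

sign : Bool → ℤ
sign true  = - + 1
sign false = + 1

sign-∧ : ∀ a b → ⟦ a ∧ b ⟧ * + 4 + (sign a + sign b) ≡ sign a * sign b + + 1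
sign-∧ true  true  = ≡.refl
sign-∧ true  false = ≡.refl
sign-∧ false true  = ≡.refl
sign-∧ false false = ≡.refl

sign-xor : ∀ a b → sign ((a ∧ not b) ∨ (not a ∧ b)) ≡ sign a * sign b
sign-xor true  true  = ≡.refl
sign-xor true  false = ≡.refl
sign-xor false true  = ≡.refl
sign-xor false false = ≡.refl

symplecticEntry⇔sign : ∀ b t → (- (+ 2) * (if b then + 1 else + 0) ≡ t - + 1) ⇔ (sign b ≡ t)
symplecticEntry⇔sign b t =
  mk⇔ (λ entry → -1-injective (≡.trans (sym (entry≡sign-1 b)) entry)) (λ { ≡.refl → entry≡sign-1 b })
  where
  entry≡sign-1 : ∀ b → - (+ 2) * (if b then + 1 else + 0) ≡ sign b - + 1
  entry≡sign-1 true  = ≡.refl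
  entry≡sign-1 false = ≡.refl
  -1+1 : ∀ i → i - + 1 + + 1 ≡ i
  -1+1 = solve-∀
  -1-injective : ∀ {i j} → i - + 1 ≡ j - + 1 → i ≡ j
  -1-injective {i} {j} i-1≡j-1 = ≡.trans (sym (-1+1 i)) (≡.trans (cong (_+ + 1) i-1≡j-1) (-1+1 j))

module SymplecticDevelopment
  (G : FinGroup) (D : FinGroup.Carrier G → Bool) (n : ℕ) (σ τ : Fin (4 ^ n) ⤖ FinGroup.Carrier G)
  (entries : ∀ i j → - (+ 2) * devMatrix (FinGroup.raw G) D (Bijection.to σ i) (Bijection.to τ j)
                     ≡ tensorPow n i j - + 1)
  where
  open FinGroup G
  open FinGroupProperties G
  open Group group using (_\\_)

  τ-onto : ∀ g → ∃[ j ] Bijection.to τ j ≡ g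
  τ-onto g with j , τ≡ ← Bijection.surjective τ g = j , τ≡ ≡.refl

  sign-translate≡tensorPow : ∀ i j → sign (D (Bijection.to τ j \\ Bijection.to σ i)) ≡ tensorPow n i j
  sign-translate≡tensorPow i j = ≡.trans (cong sign (sym (inTranslateᵇ≡ D _ _)))
                                         (Equivalence.to (symplecticEntry⇔sign _ _) (entries i j))

  ∑-over-σ : ∀ f → ∑ elems f ≡ ∑[ i ∈ allFin (4 ^ n) ] f (Bijection.to σ i)
  ∑-over-σ f = ∑-⤖ f σ (allFin-enumeration (4 ^ n)) elems-enumeration

  translate-signSum : ∀ g → ∑[ x ∈ elems ] sign (D (g \\ x)) ≡ + (2 ^ n)
  translate-signSum g with j , ≡.refl ← τ-onto g =
    ≡.trans (∑-over-σ _)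
    (≡.trans (∑-cong (allFin (4 ^ n)) (λ i → sign-translate≡tensorPow i j)) (columnSum-tensorPow n j))

  translate-signDot : ∀ g h → g ≢ h → ∑[ x ∈ elems ] sign (D (g \\ x)) * sign (D (h \\ x)) ≡ + 0
  translate-signDot g h g≢h with j , ≡.refl ← τ-onto g | j′ , ≡.refl ← τ-onto h =
    ≡.trans (∑-over-σ _)
    (≡.trans (∑-cong (allFin (4 ^ n)) λ i →
                cong₂ _*_ (sign-translate≡tensorPow i j) (sign-translate≡tensorPow i j′))
             (columnDot-tensorPow n j j′ (g≢h ∘ cong (Bijection.to τ))))

  diffCount-identity : ∀ g → g ≢ ε → diffCount raw D g ℕ.* 4 ℕ.+ (2 ^ n ℕ.+ 2 ^ n) ≡ length elems
  diffCount-identity g g≢ε = ℤ.+-injective (begin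
    + (c ℕ.* 4 ℕ.+ (2 ^ n ℕ.+ 2 ^ n))
      ≡⟨ ≡.trans (ℤ.pos-+ (c ℕ.* 4) _) (cong₂ _+_ (ℤ.pos-* c 4) (ℤ.pos-+ (2 ^ n) (2 ^ n))) ⟩
    + c * + 4 + (+ (2 ^ n) + + (2 ^ n))
      ≡⟨ cong₂ _+_ (cong (_* + 4) count)
                   (cong₂ _+_ (sym (translate-signSum ε)) (sym (translate-signSum g))) ⟩
    (∑[ x ∈ elems ] ⟦ Dε x ∧ Dg x ⟧) * + 4
      + ((∑[ x ∈ elems ] sign (Dε x)) + (∑[ x ∈ elems ] sign (Dg x)))
      ≡⟨ cong₂ _+_ (∑-*ʳ elems (+ 4) _) (∑-+ elems _ _) ⟨
    (∑[ x ∈ elems ] ⟦ Dε x ∧ Dg x ⟧ * + 4) + (∑[ x ∈ elems ] (sign (Dε x) + sign (Dg x)))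
      ≡⟨ ∑-+ elems _ _ ⟨
    ∑[ x ∈ elems ] (⟦ Dε x ∧ Dg x ⟧ * + 4 + (sign (Dε x) + sign (Dg x)))
      ≡⟨ ∑-cong elems (λ x → sign-∧ (Dε x) (Dg x)) ⟩
    ∑[ x ∈ elems ] (sign (Dε x) * sign (Dg x) + + 1)
      ≡⟨ ∑-+ elems _ _ ⟩
    (∑[ x ∈ elems ] sign (Dε x) * sign (Dg x)) + (∑[ x ∈ elems ] + 1)
      ≡⟨ cong₂ _+_ (translate-signDot ε g (g≢ε ∘ sym)) (∑-const elems (+ 1)) ⟩
    + 0 + + length elems * + 1
      ≡⟨ ≡.trans (ℤ.+-identityˡ _) (ℤ.*-identityʳ _) ⟩
    + length elems ∎)
    where
    open ≡.≡-Reasoning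
    c : ℕ
    c = diffCount raw D g
    Dε Dg : Carrier → Bool
    Dε x = D (ε \\ x)
    Dg x = D (g \\ x)
    count : + c ≡ ∑[ x ∈ elems ] ⟦ Dε x ∧ Dg x ⟧
    count = ≡.trans (diffCount≡∑ D g)
                    (∑-cong elems λ x → cong (λ y → ⟦ D y ∧ Dg x ⟧) (sym (ε\\x≡x x)))

symplectic⇒differenceSet : (G : FinGroup) (D : FinGroup.Carrier G → Bool) (n : ℕ) →
                           IsoToSymplectic (FinGroup.raw G) D n →
                           ∃[ v ] ∃[ k ] ∃[ λ′ ] IsDifferenceSet (FinGroup.raw G) v k λ′ D
symplectic⇒differenceSet G D n (σ , τ , entries) =
  length elems , card raw D , (length elems ∸ 2ⁿ⁺¹) / 4 , ≡.refl , ≡.refl , λ g g≢ε → begin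
    diffCount raw D g                                ≡⟨ m*n/n≡m (diffCount raw D g) 4 ⟨
    diffCount raw D g ℕ.* 4 / 4                      ≡⟨ cong (_/ 4) (m+n∸n≡m (diffCount raw D g ℕ.* 4) 2ⁿ⁺¹) ⟨
    (diffCount raw D g ℕ.* 4 ℕ.+ 2ⁿ⁺¹ ∸ 2ⁿ⁺¹) / 4   ≡⟨ cong (λ v → (v ∸ 2ⁿ⁺¹) / 4) (diffCount-identity g g≢ε) ⟩
    (length elems ∸ 2ⁿ⁺¹) / 4                        ∎
  where
  open FinGroup G
  open SymplecticDevelopment G D n σ τ entries
  open ≡.≡-Reasoning
  2ⁿ⁺¹ : ℕ
  2ⁿ⁺¹ = 2 ^ n ℕ.+ 2 ^ n

module _ (N H : FinGroup) (φ : FinGroup.Carrier H → FinGroup.Carrier N → FinGroup.Carrier N)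
         (action : IsAutAction N H φ) where
  private
    module N = FinGroup N
    module H = FinGroup H
    module N′ = Group (FinGroupProperties.group N)
    module H′ = Group (FinGroupProperties.group H)
  open IsAutAction action

  φ-ε : ∀ h → φ h N.ε ≡ N.ε
  φ-ε h = GroupProperties.identityʳ-unique (FinGroupProperties.group N) (φ h N.ε) (φ h N.ε)
            (≡.trans (sym (φ-auto-hom h N.ε N.ε)) (cong (φ h) (N′.identityˡ N.ε)))

  φ-identity : ∀ a → φ H.ε a ≡ a
  φ-identity a = proj₁ (φ-auto-bij H.ε)
    (≡.trans (sym (φ-hom H.ε H.ε a)) (cong (λ h → φ h a) (H′.identityˡ H.ε)))

  semidirect-isGroup : IsGroup _≡_ (RawFinGroup._∙_ (semidirect N H φ)) (N.ε , H.ε)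
                                   (RawFinGroup._⁻¹ (semidirect N H φ))
  semidirect-isGroup = record
    { isMonoid = record
      { isSemigroup = record
        { isMagma = record { isEquivalence = isEquivalence ; ∙-cong = cong₂ _ }
        ; assoc   = λ (a , h) (b , k) (c , l) → cong₂ _,_ (assoc a b c h k) (H′.assoc h k l)
        }
      ; identity = (λ (a , h) → cong₂ _,_ (≡.trans (N′.identityˡ _) (φ-identity a)) (H′.identityˡ h))
                 , (λ (a , h) → cong₂ _,_ (≡.trans (cong (a N.∙_) (φ-ε h)) (N′.identityʳ a))
                                           (H′.identityʳ h))
      }
    ; inverse = (λ (a , h) → cong₂ _,_ (inverseˡ a (h H.⁻¹)) (H′.inverseˡ h))
              , (λ (a , h) → cong₂ _,_ (inverseʳ a h) (H′.inverseʳ h))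
    ; ⁻¹-cong = cong (RawFinGroup._⁻¹ (semidirect N H φ))
    }
    where
    open ≡.≡-Reasoning
    assoc : ∀ a b c h k → (a N.∙ φ h b) N.∙ φ (h H.∙ k) c ≡ a N.∙ φ h (b N.∙ φ k c)
    assoc a b c h k = begin
      (a N.∙ φ h b) N.∙ φ (h H.∙ k) c  ≡⟨ cong ((a N.∙ φ h b) N.∙_) (φ-hom h k c) ⟩
      (a N.∙ φ h b) N.∙ φ h (φ k c)    ≡⟨ N′.assoc a (φ h b) (φ h (φ k c)) ⟩
      a N.∙ (φ h b N.∙ φ h (φ k c))    ≡⟨ cong (a N.∙_) (φ-auto-hom h b (φ k c)) ⟨
      a N.∙ φ h (b N.∙ φ k c)          ∎
    inverseˡ : ∀ a h → φ h (a N.⁻¹) N.∙ φ h a ≡ N.ε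
    inverseˡ a h =
      ≡.trans (sym (φ-auto-hom h (a N.⁻¹) a)) (≡.trans (cong (φ h) (N′.inverseˡ a)) (φ-ε h))
    inverseʳ : ∀ a h → a N.∙ φ h (φ (h H.⁻¹) (a N.⁻¹)) ≡ N.ε
    inverseʳ a h = begin
      a N.∙ φ h (φ (h H.⁻¹) (a N.⁻¹))    ≡⟨ cong (a N.∙_) (φ-hom h (h H.⁻¹) (a N.⁻¹)) ⟨
      a N.∙ φ (h H.∙ (h H.⁻¹)) (a N.⁻¹)  ≡⟨ cong (λ k → a N.∙ φ k (a N.⁻¹)) (H′.inverseʳ h) ⟩
      a N.∙ φ H.ε (a N.⁻¹)               ≡⟨ cong (a N.∙_) (φ-identity (a N.⁻¹)) ⟩
      a N.∙ (a N.⁻¹)                     ≡⟨ N′.inverseʳ a ⟩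
      N.ε                                ∎

  semidirectFinGroup : FinGroup
  semidirectFinGroup = record { raw = semidirect N H φ ; isGroup = semidirect-isGroup }

trivialAction : (N H : FinGroup) → IsAutAction N H (λ _ a → a)
trivialAction N H = record
  { φ-auto-hom = λ _ _ _ → ≡.refl
  ; φ-auto-bij = λ _ → Identity.bijective _≡_
  ; φ-hom      = λ _ _ _ → ≡.refl
  }

-- Its raw group is definitionally `direct N H`.
directFinGroup : FinGroup → FinGroup → FinGroup
directFinGroup N H = semidirectFinGroup N H (λ _ a → a) (trivialAction N H)

module _ (G₁ G₂ : FinGroup) (D₁ : FinGroup.Carrier G₁ → Bool) (D₂ : FinGroup.Carrier G₂ → Bool) where
  private
    module G₁ = FinGroup G₁
    module G₂ = FinGroup G₂
    D = productSet G₁ G₂ D₁ D₂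

  sign-translate-productSet : ∀ g₁ g₂ x₁ x₂ →
    sign (inTranslateᵇ (direct G₁ G₂) D (g₁ , g₂) (x₁ , x₂))
      ≡ sign (inTranslateᵇ G₁.raw D₁ g₁ x₁) * sign (inTranslateᵇ G₂.raw D₂ g₂ x₂)
  sign-translate-productSet g₁ g₂ x₁ x₂ = begin
    sign (inTranslateᵇ (direct G₁ G₂) D (g₁ , g₂) (x₁ , x₂))
      ≡⟨ cong sign (inTranslateᵇ≡ (directFinGroup G₁ G₂) D (g₁ , g₂) (x₁ , x₂)) ⟩
    sign (D (y₁ , y₂))
      ≡⟨ sign-xor (D₁ y₁) (D₂ y₂) ⟩
    sign (D₁ y₁) * sign (D₂ y₂)
      ≡⟨ cong₂ (λ b₁ b₂ → sign b₁ * sign b₂) (inTranslateᵇ≡ G₁ D₁ g₁ x₁) (inTranslateᵇ≡ G₂ D₂ g₂ x₂) ⟨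
    sign (inTranslateᵇ G₁.raw D₁ g₁ x₁) * sign (inTranslateᵇ G₂.raw D₂ g₂ x₂) ∎
    where
    open ≡.≡-Reasoning
    open FinGroupProperties using (inTranslateᵇ≡)
    y₁ = (g₁ G₁.⁻¹) G₁.∙ x₁
    y₂ = (g₂ G₂.⁻¹) G₂.∙ x₂

  productSet-symplectic : ∀ n₁ n₂ → IsoToSymplectic G₁.raw D₁ n₁ → IsoToSymplectic G₂.raw D₂ n₂ →
                          IsoToSymplectic (direct G₁ G₂) D (n₁ ℕ.+ n₂)
  productSet-symplectic n₁ n₂ (σ₁ , τ₁ , entries₁) (σ₂ , τ₂ , entries₂) = σ , τ , entries
    where
    σ τ : Fin (4 ^ (n₁ ℕ.+ n₂)) ⤖ (G₁.Carrier × G₂.Carrier)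
    σ = (σ₁ ×-⤖ σ₂) ⤖-∘ ↔⇒⤖ (4^+↔× n₁ n₂)
    τ = (τ₁ ×-⤖ τ₂) ⤖-∘ ↔⇒⤖ (4^+↔× n₁ n₂)
    entries : ∀ i j → - (+ 2) * devMatrix (direct G₁ G₂) D (Bijection.to σ i) (Bijection.to τ j)
                      ≡ tensorPow (n₁ ℕ.+ n₂) i j - + 1
    entries i j = Equivalence.from (symplecticEntry⇔sign _ _) (begin
      sign (inTranslateᵇ (direct G₁ G₂) D (Bijection.to τ j) (Bijection.to σ i))
        ≡⟨ sign-translate-productSet _ _ _ _ ⟩
      sign (inTranslateᵇ G₁.raw D₁ (Bijection.to τ₁ a′) (Bijection.to σ₁ a))
        * sign (inTranslateᵇ G₂.raw D₂ (Bijection.to τ₂ b′) (Bijection.to σ₂ b))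
        ≡⟨ cong₂ _*_ (Equivalence.to (symplecticEntry⇔sign _ (tensorPow n₁ a a′)) (entries₁ a a′))
                     (Equivalence.to (symplecticEntry⇔sign _ (tensorPow n₂ b b′)) (entries₂ b b′)) ⟩
      tensorPow n₁ a a′ * tensorPow n₂ b b′
        ≡⟨ tensorPow-+ n₁ n₂ i j ⟨
      tensorPow (n₁ ℕ.+ n₂) i j ∎)
      where
      open ≡.≡-Reasoning
      a  = proj₁ (splitDigits n₁ n₂ i)
      b  = proj₂ (splitDigits n₁ n₂ i)
      a′ = proj₁ (splitDigits n₁ n₂ j)
      b′ = proj₂ (splitDigits n₁ n₂ j)

module _ (G₁ G₂ : FinGroup) (φ : FinGroup.Carrier G₂ → FinGroup.Carrier G₁ → FinGroup.Carrier G₁)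
         (D : FinGroup.Carrier G₁ × FinGroup.Carrier G₂ → Bool)
         (same : ∀ r → SameTranslates (RawFinGroup._∙_ (semidirect G₁ G₂ φ))
                                      (RawFinGroup._∙_ (direct G₁ G₂)) D r)
  where

  sameTranslates⇒inTranslateᵇ≡ : ∀ g x →
    inTranslateᵇ (semidirect G₁ G₂ φ) D g x ≡ inTranslateᵇ (direct G₁ G₂) D g x
  sameTranslates⇒inTranslateᵇ≡ g x = ⇔→≡
    (⇔-sym (inTranslateᵇ⇔InTranslate (direct G₁ G₂) D g x)
      ⇔-∘ (mk⇔ (proj₁ (same g x)) (proj₂ (same g x))
      ⇔-∘ inTranslateᵇ⇔InTranslate (semidirect G₁ G₂ φ) D g x))

  semidirect-symplectic : ∀ n → IsoToSymplectic (direct G₁ G₂) D n →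
                          IsoToSymplectic (semidirect G₁ G₂ φ) D n
  semidirect-symplectic n (σ , τ , entries) = σ , τ , λ i j →
    ≡.trans (cong (λ b → - (+ 2) * (if b then + 1 else + 0)) (sameTranslates⇒inTranslateᵇ≡ _ _))
            (entries i j)

theorem4p1 : (G₁ G₂ : FinGroup)
    → (D₁ : FinGroup.Carrier G₁ → Bool) → (D₂ : FinGroup.Carrier G₂ → Bool)
    → IsSymplecticDifferenceSet (FinGroup.raw G₁) D₁
    → IsSymplecticDifferenceSet (FinGroup.raw G₂) D₂
    → (φ : FinGroup.Carrier G₂ → FinGroup.Carrier G₁ → FinGroup.Carrier G₁)
    → IsAutAction G₁ G₂ φ
    → (∀ (r : FinGroup.Carrier G₁ × FinGroup.Carrier G₂)
         → SameTranslates (RawFinGroup._∙_ (semidirect G₁ G₂ φ)) (RawFinGroup._∙_ (direct G₁ G₂))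
             (productSet G₁ G₂ D₁ D₂) r)
    → IsSymplecticDifferenceSet (semidirect G₁ G₂ φ) (productSet G₁ G₂ D₁ D₂)
theorem4p1 G₁ G₂ D₁ D₂ (_ , n₁ , iso₁) (_ , n₂ , iso₂) φ action same =
  symplectic⇒differenceSet (semidirectFinGroup G₁ G₂ φ action) D n iso , n , iso
  where
  D = productSet G₁ G₂ D₁ D₂
  n = n₁ ℕ.+ n₂
  iso : IsoToSymplectic (semidirect G₁ G₂ φ) D n
  iso = semidirect-symplectic G₁ G₂ φ D same n (productSet-symplectic G₁ G₂ D₁ D₂ n₁ n₂ iso₁ iso₂)
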